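{- Let $n\ge1$, let $I$ be a suffix-compatible mapping on $\{0,1\}^n$, and let $B$ be a mapping on $\{0,1\}^n$ computed by an in situ program $(b_1,1),(b_2,2),\dots,(b_n,n)$ (signature $1,\dots,n$). Then $B\circ I$ is computed by an in situ program with signature $1,\dots,n$, namely $(p_1,1),\dots,(p_n,n)$ where, for every $(x_1,\dots,x_n)$ with $B\circ I(x_1,\dots,x_n)=(y_1,\dots,y_n)$ and every $i$, $p_i(y_1,\dots,y_{i-1},x_i,\dots,x_n)=y_i$ (this condition well defines $p_i$ on all vectors that occur).
   Context: An in situ program of a mapping $E:\{0,1\}^n\to\{0,1\}^n$ is a finite sequence $(\psi_1,i_1),\dots,(\psi_m,i_m)$ with $\psi_k:\{0,1\}^n\to\{0,1\}$, $i_k\in\{1,\dots,n\}$, such that for every $X$, setting $X_0=X$ and letting $X_k$ equal $X_{k-1}$ except that its $i_k$-th component is replaced by $\psi_k(X_{k-1})$, one has $X_m=E(X)$; its signature is $i_1,\dots,i_m$. The suffix of order $k$ of $(x_1,\dots,x_n)$ is $(x_k,\dots,x_n)$. A mapping $I$ of $\{0,1\}^n$ is suffix-compatible if for every $1\le k\le n$, whenever $X,X'$ have the same suffix of order $k$, $I(X),I(X')$ also have the same suffix of order $k$. -}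

module Defs where

open import Data.Bool using (Bool; if_then_else_)
open import Data.Nat using (ℕ; suc; _≤_)
open import Data.Fin using (Fin; toℕ; _<?_)
open import Data.Vec using (Vec; lookup; tabulate; _[_]≔_)
open import Data.List using (List; foldl; map; allFin)
open import Data.Product using (_×_; _,_; proj₂)
open import Relation.Nullary using (does)
open import Relation.Binary.PropositionalEquality using (_≡_)

-- Boolean vectors {0,1}^n ; component i (1-indexed in the paper) is Fin index i-1.
BVec : ℕ → Set
BVec n = Vec Bool n

Program : ℕ → Set
Program n = List ((BVec n → Bool) × Fin n)

step : ∀ {n} → BVec n → (BVec n → Bool) × Fin n → BVec n
step X (ψ , i) = X [ i ]≔ ψ X

run : ∀ {n} → Program n → BVec n → BVec n
run P X = foldl step X P

Computes : ∀ {n} → Program n → (BVec n → BVec n) → Set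
Computes P E = ∀ X → run P X ≡ E X

signature : ∀ {n} → Program n → List (Fin n)
signature P = map proj₂ P

seqProgram : ∀ {n} → (Fin n → BVec n → Bool) → Program n
seqProgram {n} p = map (λ i → (p i , i)) (allFin n)

-- X and X' have the same suffix of order k (components k..n, 1-indexed).
SameSuffix : ∀ {n} → ℕ → BVec n → BVec n → Set
SameSuffix {n} k X X' = ∀ (j : Fin n) → k ≤ suc (toℕ j) → lookup X j ≡ lookup X' j

SuffixCompatible : ∀ {n} → (BVec n → BVec n) → Set
SuffixCompatible {n} I =
  ∀ (k : ℕ) → 1 ≤ k → k ≤ n → ∀ X X' → SameSuffix k X X' → SameSuffix k (I X) (I X')

-- (y_1,...,y_{i-1},x_i,...,x_n) for the (0-indexed) Fin position i.
mix : ∀ {n} → BVec n → BVec n → Fin n → BVec n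
mix Y X i = tabulate (λ j → if does (j <? i) then lookup Y j else lookup X j)

-- While the sequential program runs on X, the vector seen at step i is (y₁ … y_{i-1}, x_i … x_n),
-- where Y is its output; so a program with signature 1, …, n computes Y from X exactly when each
-- p_i sends that vector to y_i.  The program for B ∘ I evaluates b_i at (y₁ … y_{i-1}, I(Z)_i … I(Z)_n)
-- for the current vector Z; Z agrees with X from position i on, hence by suffix compatibility
-- I(Z) agrees with I(X) there, and b_i sees exactly what it sees when B runs on I(X).
module Submission where

open import Defs
open import Data.Nat using (ℕ; zero; suc; _≤_; s≤s; z≤n)
open import Data.Nat.Properties using (≤-pred; <⇒≱; ≮⇒≥)
open import Data.Fin as Fin using (Fin; zero; suc; _<_; _<?_; toℕ)
open import Data.Fin.Properties using (toℕ<n)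
open import Data.Bool using (Bool; if_then_else_)
open import Data.Vec using ([]; _∷_; lookup)
open import Data.Vec.Properties using (lookup∘tabulate; ∷-injective)
open import Data.Vec.Relation.Binary.Pointwise.Extensional using (ext; Pointwise-≡⇒≡)
open import Data.List using (allFin)
import Data.List as List
open import Data.List.Properties using (map-∘; map-id; map-tabulate)
open import Data.Product using (Σ; _×_; _,_)
open import Function using (_∘_)
open import Relation.Nullary using (yes; no; does)
open import Relation.Nullary.Decidable using (dec-true; dec-false)
open import Relation.Binary.PropositionalEquality using (_≡_; refl; sym; trans; cong; module ≡-Reasoning)

private
  variable
    n : ℕ

lookup-mix : (Y X : BVec n) (i j : Fin n) →
             lookup (mix Y X i) j ≡ (if does (j <? i) then lookup Y j else lookup X j)
lookup-mix Y X i = lookup∘tabulate (λ j → if does (j <? i) then lookup Y j else lookup X j)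

lookup-mix-< : (Y X : BVec n) {i j : Fin n} → j < i → lookup (mix Y X i) j ≡ lookup Y j
lookup-mix-< Y X {i} {j} j<i =
  trans (lookup-mix Y X i j) (cong (λ b → if b then lookup Y j else lookup X j) (dec-true (j <? i) j<i))

lookup-mix-≥ : (Y X : BVec n) {i j : Fin n} → i Fin.≤ j → lookup (mix Y X i) j ≡ lookup X j
lookup-mix-≥ Y X {i} {j} i≤j =
  trans (lookup-mix Y X i j)
        (cong (λ b → if b then lookup Y j else lookup X j) (dec-false (j <? i) (λ j<i → <⇒≱ j<i i≤j)))

mix-cong : (Y Y′ X X′ : BVec n) (i : Fin n) →
           (∀ j → j < i → lookup Y j ≡ lookup Y′ j) → (∀ j → i Fin.≤ j → lookup X j ≡ lookup X′ j) →
           mix Y X i ≡ mix Y′ X′ i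
mix-cong Y Y′ X X′ i eqY eqX = Pointwise-≡⇒≡ (ext pointwise)
  where
  pointwise : ∀ j → lookup (mix Y X i) j ≡ lookup (mix Y′ X′ i) j
  pointwise j with j <? i
  ... | yes j<i = trans (lookup-mix-< Y X j<i) (trans (eqY j j<i) (sym (lookup-mix-< Y′ X′ j<i)))
  ... | no  j≮i = trans (lookup-mix-≥ Y X i≤j) (trans (eqX j i≤j) (sym (lookup-mix-≥ Y′ X′ i≤j)))
    where i≤j = ≮⇒≥ j≮i

mix-zero : (Y X : BVec (suc n)) → mix Y X zero ≡ X
mix-zero Y X = Pointwise-≡⇒≡ (ext (λ j → lookup-mix-≥ Y X {zero} {j} z≤n))

mix-idem : (Y X Z : BVec n) (i : Fin n) → mix (mix Y X i) Z i ≡ mix Y Z i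
mix-idem Y X Z i = mix-cong (mix Y X i) Y Z Z i (λ j → lookup-mix-< Y X) (λ _ _ → refl)

mix-sameSuffix : (Y X : BVec n) (i : Fin n) → SameSuffix (suc (toℕ i)) (mix Y X i) X
mix-sameSuffix Y X i j i<j = lookup-mix-≥ Y X (≤-pred i<j)

run-tabulate-suc : ∀ {m} (ψ : Fin m → BVec (suc n) → Bool) (ι : Fin m → Fin n) (y : Bool) (X : BVec n) →
                   run (List.tabulate (λ j → ψ j , suc (ι j))) (y ∷ X)
                   ≡ y ∷ run (List.tabulate (λ j → ψ j ∘ (y ∷_) , ι j)) X
run-tabulate-suc {m = zero}  ψ ι y X = refl
run-tabulate-suc {m = suc m} ψ ι y X = run-tabulate-suc (ψ ∘ suc) (ι ∘ suc) y _

seqProgram-tabulate : (q : Fin n → BVec n → Bool) → seqProgram q ≡ List.tabulate (λ i → q i , i)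
seqProgram-tabulate q = map-tabulate (λ i → i) (λ i → q i , i)

run-seqProgram-∷ : (q : Fin (suc n) → BVec (suc n) → Bool) (x : Bool) (X : BVec n) →
                   let y = q zero (x ∷ X) in
                   run (seqProgram q) (x ∷ X) ≡ y ∷ run (seqProgram (λ j → q (suc j) ∘ (y ∷_))) X
run-seqProgram-∷ q x X = begin
  run (seqProgram q) (x ∷ X)
    ≡⟨ cong (λ P → run P (x ∷ X)) (seqProgram-tabulate q) ⟩
  run (List.tabulate (λ j → q (suc j) , suc j)) (y ∷ X)
    ≡⟨ run-tabulate-suc (q ∘ suc) (λ j → j) y X ⟩
  y ∷ run (List.tabulate (λ j → q (suc j) ∘ (y ∷_) , j)) X
    ≡⟨ cong (λ P → y ∷ run P X) (sym (seqProgram-tabulate (λ j → q (suc j) ∘ (y ∷_)))) ⟩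
  y ∷ run (seqProgram (λ j → q (suc j) ∘ (y ∷_))) X ∎
  where
  open ≡-Reasoning
  y = q zero (x ∷ X)

run-seqProgram⇒mix : (q : Fin n → BVec n → Bool) (X Y : BVec n) →
                     run (seqProgram q) X ≡ Y → ∀ i → q i (mix Y X i) ≡ lookup Y i
run-seqProgram⇒mix q (x ∷ X) (y ∷ Y) eq i
  with ∷-injective (trans (sym (run-seqProgram-∷ q x X)) eq)
run-seqProgram⇒mix q (x ∷ X) (y ∷ Y) eq zero    | refl , _   = cong (q zero) (mix-zero (y ∷ Y) (x ∷ X))
run-seqProgram⇒mix q (x ∷ X) (y ∷ Y) eq (suc i) | refl , eqY =
  run-seqProgram⇒mix (λ j → q (suc j) ∘ (y ∷_)) X Y eqY i

mix⇒run-seqProgram : (q : Fin n → BVec n → Bool) (X Y : BVec n) →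
                     (∀ i → q i (mix Y X i) ≡ lookup Y i) → run (seqProgram q) X ≡ Y
mix⇒run-seqProgram q [] [] _ = refl
mix⇒run-seqProgram q (x ∷ X) (y ∷ Y) eqs
  with trans (cong (q zero) (sym (mix-zero (y ∷ Y) (x ∷ X)))) (eqs zero)
... | refl = trans (run-seqProgram-∷ q x X)
                   (cong (y ∷_) (mix⇒run-seqProgram (λ j → q (suc j) ∘ (y ∷_)) X Y (eqs ∘ suc)))

signature-seqProgram : (p : Fin n → BVec n → Bool) → signature (seqProgram p) ≡ allFin n
signature-seqProgram {n} p = trans (sym (map-∘ (allFin n))) (map-id (allFin n))

mix-suffixCompatible : (I : BVec n → BVec n) → SuffixCompatible I →
                       (Y X : BVec n) (i : Fin n) → mix Y (I (mix Y X i)) i ≡ mix Y (I X) i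
mix-suffixCompatible I compatible Y X i =
  mix-cong Y Y (I (mix Y X i)) (I X) i (λ _ _ → refl) (λ j i≤j → sameSuffix j (s≤s i≤j))
  where
  sameSuffix : SameSuffix (suc (toℕ i)) (I (mix Y X i)) (I X)
  sameSuffix = compatible (suc (toℕ i)) (s≤s z≤n) (toℕ<n i) (mix Y X i) X (mix-sameSuffix Y X i)

proposition23 : (n : ℕ) → 1 ≤ n → (I B : BVec n → BVec n) → SuffixCompatible I
    → Σ (Fin n → BVec n → Bool) (λ b → Computes (seqProgram b) B)
    → Σ (Fin n → BVec n → Bool) (λ p →
    signature (seqProgram p) ≡ allFin n
    × Computes (seqProgram p) (B ∘ I)
    × (∀ (X : BVec n) (i : Fin n) → p i (mix (B (I X)) X i) ≡ lookup (B (I X)) i))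
proposition23 n _ I B compatible (b , b-computes) =
  p , signature-seqProgram p , (λ X → mix⇒run-seqProgram p X (B (I X)) (p-local X)) , p-local
  where
  p : Fin n → BVec n → Bool
  p i Z = b i (mix Z (I Z) i)

  p-local : ∀ X i → p i (mix (B (I X)) X i) ≡ lookup (B (I X)) i
  p-local X i = begin
    b i (mix (mix Y X i) (I (mix Y X i)) i) ≡⟨ cong (b i) (mix-idem Y X (I (mix Y X i)) i) ⟩
    b i (mix Y (I (mix Y X i)) i)           ≡⟨ cong (b i) (mix-suffixCompatible I compatible Y X i) ⟩
    b i (mix Y (I X) i)                     ≡⟨ run-seqProgram⇒mix b (I X) Y (b-computes (I X)) i ⟩
    lookup Y i                              ∎
    where
    open ≡-Reasoning
    Y = B (I X)
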